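{- Let $r$ be a positive integer and let $n$ satisfy $\lfloor n/2\rfloor>r$. Then the $r$th moment of the positive Eulerian distribution on $\{1,\dots,n\}$, and likewise the $r$th moment of the negative Eulerian distribution, equals the $r$th moment of the Eulerian distribution on $\{1,\dots,n\}$.
   Context: For $w\in S_n$, $\mathrm{des}(w)=|\{1\le i\le n-1:w(i)>w(i+1)\}|$; $S_n^{\pm}$ denote the sets of permutations with sign $\pm1$. The Eulerian distribution is the law of $\mathrm{des}(w)+1$ for $w$ uniform in $S_n$, i.e. $k\mapsto \langle n,k\rangle/n!$ with $\langle n,k\rangle=|\{w\in S_n:\mathrm{des}(w)=k-1\}|$. The positive (resp. negative) Eulerian distribution is the law of $\mathrm{des}(w)+1$ for $w$ uniform in $S_n^{+}$ (resp. $S_n^-$), i.e. $k\mapsto\langle n,k\rangle^{\pm}/|S_n^\pm|$ with $\langle n,k\rangle^{\pm}=|\{w\in S_n^{\pm}:\mathrm{des}(w)=k-1\}|$. -}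

module Defs where

open import Data.Nat using (ℕ; zero; suc; _+_; _*_; _^_; _<ᵇ_)
open import Data.Nat.Properties using ()
open import Data.Bool using (Bool; true; false; if_then_else_; not)
open import Data.Fin using (Fin; toℕ)
open import Data.Fin.Properties using (_≟_)
open import Data.List using (List; []; _∷_; map; concatMap; filter; filterᵇ; length; allFin)
open import Data.Nat.ListAction using (sum)
import Data.List.Relation.Unary.Unique.DecPropositional as UDec
open import Data.Nat using (_%_)

words : (n k : ℕ) → List (List (Fin n))
words n zero    = [] ∷ []
words n (suc k) = concatMap (λ a → map (a ∷_) (words n k)) (allFin n)

-- The symmetric group S_n, each permutation w given in one-line notation
-- [w(1), ..., w(n)] (values shifted to Fin n = {0,...,n-1}):
-- the words of length n over Fin n with no repeated letter.

perms : (n : ℕ) → List (List (Fin n))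
perms n = filter (UDec.unique? (_≟_ {n})) (words n n)

des : ∀ {n} → List (Fin n) → ℕ
des []            = 0
des (x ∷ [])      = 0
des (x ∷ y ∷ ys)  = (if toℕ y <ᵇ toℕ x then 1 else 0) + des (y ∷ ys)

inv : ∀ {n} → List (Fin n) → ℕ
inv []       = 0
inv (x ∷ xs) = sum (map (λ y → if toℕ y <ᵇ toℕ x then 1 else 0) xs) + inv xs

isEven : ∀ {n} → List (Fin n) → Bool
isEven w = (inv w % 2) Data.Nat.≡ᵇ 0

permsPos : (n : ℕ) → List (List (Fin n))
permsPos n = filterᵇ isEven (perms n)

permsNeg : (n : ℕ) → List (List (Fin n))
permsNeg n = filterᵇ (λ w → not (isEven w)) (perms n)

-- Sum over a finite set of permutations of (des(w)+1)^r.
-- The r-th moment of des+1 for w uniform in the set S is  powerSum r S / |S|.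
powerSum : ∀ {n} → ℕ → List (List (Fin n)) → ℕ
powerSum r ws = sum (map (λ w → (des w + 1) ^ r) ws)

-- Let τ exchange the adjacent values A and A + 1 of a permutation w in one-line notation.
-- Then sign (τ w) = − sign w and des (τ w) − des w = [A is directly followed by A + 1 in w]
-- − [A + 1 is directly followed by A in w], at most one of the two brackets being 1.
-- Pairing w with τ w therefore turns Σ_w sign w · c w · G (des w), for any τ-invariant c,
-- into Σ_w sign w · c w · [A is directly followed by A + 1 in w] · (G (des w) − G (des w + 1)).
-- Doing this for the disjoint pairs (0,1), (2,3), …, (2m − 2, 2m − 1), m = ⌊n/2⌋, replaces G
-- by its m-th difference, which vanishes for G d = (d + 1)^r when r < m. Hence the power sums
-- Σ (des w + 1)^r over S_n^+ and over S_n^- agree for every r < m; the case r = 0 gives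
-- |S_n^+| = |S_n^-|, and the equality of moments follows.

module Submission where

open import Data.Bool using (Bool; true; false; if_then_else_; _∧_; not)
open import Data.Empty using (⊥-elim)
open import Data.Fin using (Fin; toℕ; punchOut; fromℕ<)
import Data.Fin as Fin
open import Data.Fin.Permutation using (Permutation′; transpose; _⟨$⟩ʳ_)
open import Data.Fin.Properties using (toℕ-injective; toℕ-fromℕ<; punchOut-injective; <⇒notInjective) renaming (_≟_ to _≟ᶠ_)
open import Data.List using (List; []; _∷_; map; length; lookup; allFin; _++_; concatMap; filter; filterᵇ; tabulate)
open import Data.List.Membership.Propositional using (_∈_)
open import Data.List.Membership.Propositional.Properties using (∈-lookup)
open import Data.List.Relation.Unary.All using (All; []; _∷_)
import Data.List.Relation.Unary.All as All
open import Data.List.Relation.Unary.All.Properties using (map⁺; concat⁺; all-filter; filter⁺)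
open import Data.List.Relation.Unary.AllPairs using ([]; _∷_)
open import Data.List.Relation.Unary.Any using (Any; any?)
import Data.List.Relation.Unary.Any as Any
open import Data.List.Relation.Unary.Unique.Propositional using (Unique)
import Data.List.Relation.Unary.Unique.DecPropositional as UniqueDec
import Data.List.Relation.Unary.Unique.Propositional.Properties as Unique
open import Data.Nat using (ℕ; zero; suc; _<_; _≤_; _≡ᵇ_; _<ᵇ_; _%_)
open import Data.Nat.ListAction using (sum)
open import Data.Product using (_×_; _,_; proj₁; proj₂)
open import Function using (_∘_; id; mk⇔; Injection)
open import Function.Definitions using (Injective)
open import Function.Properties.Inverse using (↔⇒↣)
open import Relation.Binary.PropositionalEquality
open import Relation.Nullary using (¬_; yes; no; does; Dec)
open import Relation.Nullary.Decidable using (dec-true; dec-false; does-⇔; _×-dec_)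
open import Relation.Unary using (Decidable)
open import Defs
import Data.Integer as ℤ
open ℤ using (ℤ; 0ℤ; 1ℤ; -1ℤ; -_)
import Data.Integer.Properties as ℤP

module _ where

  open import Data.Nat using (_+_; s≤s⁻¹)
  open import Data.Nat.Properties
  open import Data.Nat.DivMod using ([m+n]%n≡m%n)
  open import Algebra.Properties.CommutativeSemigroup +-commutativeSemigroup using () renaming (interchange to +-interchange)

  𝟙 : Bool → ℕ
  𝟙 b = if b then 1 else 0

  ≡ᵇ-true : ∀ {m n} → m ≡ n → (m ≡ᵇ n) ≡ true
  ≡ᵇ-true {m} {n} = dec-true (m ≟ n)

  ≡ᵇ-false : ∀ {m n} → m ≢ n → (m ≡ᵇ n) ≡ false
  ≡ᵇ-false {m} {n} = dec-false (m ≟ n)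

  <ᵇ-true : ∀ {m n} → m < n → (m <ᵇ n) ≡ true
  <ᵇ-true {m} {n} = dec-true (m <? n)

  <ᵇ-false : ∀ {m n} → ¬ m < n → (m <ᵇ n) ≡ false
  <ᵇ-false {m} {n} = dec-false (m <? n)

  if-true : ∀ {A : Set} {b} {x y : A} → b ≡ true → (if b then x else y) ≡ x
  if-true refl = refl

  if-false : ∀ {A : Set} {b} {x y : A} → b ≡ false → (if b then x else y) ≡ y
  if-false refl = refl

  -- Exchanging the adjacent values A and 1 + A

  adjSwap : ℕ → ℕ → ℕ
  adjSwap A v = if v ≡ᵇ A then suc A else if v ≡ᵇ suc A then A else v

  data AdjSwapView (A v : ℕ) : Set where
    at-low  : v ≡ A → adjSwap A v ≡ suc A → AdjSwapView A v
    at-high : v ≡ suc A → adjSwap A v ≡ A → AdjSwapView A v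
    away    : v ≢ A → v ≢ suc A → adjSwap A v ≡ v → AdjSwapView A v

  adjSwap-view : ∀ A v → AdjSwapView A v
  adjSwap-view A v with v ≟ A | v ≟ suc A
  ... | yes v≡A | _        = at-low v≡A (if-true (≡ᵇ-true v≡A))
  ... | no v≢A | yes v≡1+A = at-high v≡1+A (trans (if-false (≡ᵇ-false v≢A)) (if-true (≡ᵇ-true v≡1+A)))
  ... | no v≢A | no v≢1+A  = away v≢A v≢1+A (trans (if-false (≡ᵇ-false v≢A)) (if-false (≡ᵇ-false v≢1+A)))

  adjSwap-low : ∀ A → adjSwap A A ≡ suc A
  adjSwap-low A = if-true (≡ᵇ-true {A} refl)

  adjSwap-high : ∀ A → adjSwap A (suc A) ≡ A
  adjSwap-high A = trans (if-false (≡ᵇ-false {suc A} 1+n≢n)) (if-true (≡ᵇ-true {suc A} refl))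

  adjSwap-involutive : ∀ A v → adjSwap A (adjSwap A v) ≡ v
  adjSwap-involutive A v with adjSwap-view A v
  ... | at-low  refl e = trans (cong (adjSwap A) e) (adjSwap-high A)
  ... | at-high refl e = trans (cong (adjSwap A) e) (adjSwap-low A)
  ... | away _ _ e     = trans (cong (adjSwap A) e) e

  adjSwap-below : ∀ {A p} → p < A → adjSwap A p ≡ p
  adjSwap-below {A} {p} p<A with adjSwap-view A p
  ... | at-low  p≡A _   = ⊥-elim (<-irrefl p≡A p<A)
  ... | at-high p≡1+A _ = ⊥-elim (<-asym p<A (subst (A <_) (sym p≡1+A) (n<1+n A)))
  ... | away _ _ e      = e

  adjSwap-≡ᵇ : ∀ A u p → (adjSwap A u ≡ᵇ p) ≡ (u ≡ᵇ adjSwap A p)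
  adjSwap-≡ᵇ A u p = does-⇔ (mk⇔ to from) (adjSwap A u ≟ p) (u ≟ adjSwap A p)
    where
    to : adjSwap A u ≡ p → u ≡ adjSwap A p
    to e = trans (sym (adjSwap-involutive A u)) (cong (adjSwap A) e)
    from : u ≡ adjSwap A p → adjSwap A u ≡ p
    from e = trans (cong (adjSwap A) e) (adjSwap-involutive A p)

  <-suc-avoiding : ∀ {v A} → v ≢ A → (v <ᵇ suc A) ≡ (v <ᵇ A)
  <-suc-avoiding {v} {A} v≢A =
    does-⇔ (mk⇔ (λ v<1+A → ≤∧≢⇒< (s≤s⁻¹ v<1+A) v≢A) m<n⇒m<1+n) (v <? suc A) (v <? A)

  suc-<-avoiding : ∀ {u A} → u ≢ suc A → (suc A <ᵇ u) ≡ (A <ᵇ u)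
  suc-<-avoiding {u} {A} u≢1+A =
    does-⇔ (mk⇔ (<-trans (n<1+n A)) (λ A<u → ≤∧≢⇒< A<u (u≢1+A ∘ sym))) (suc A <? u) (A <? u)

  adjSwap-<ᵇ : ∀ A u v → ¬ (u ≡ A × v ≡ suc A) → ¬ (u ≡ suc A × v ≡ A) →
               (adjSwap A v <ᵇ adjSwap A u) ≡ (v <ᵇ u)
  adjSwap-<ᵇ A u v ¬lh ¬hl with adjSwap-view A u | adjSwap-view A v
  ... | at-low  refl e | at-low  refl f rewrite e | f = refl
  ... | at-low  refl e | at-high refl f = ⊥-elim (¬lh (refl , refl))
  ... | at-low  refl e | away v≢A _ f rewrite e | f = <-suc-avoiding v≢A
  ... | at-high refl e | at-low  refl f = ⊥-elim (¬hl (refl , refl))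
  ... | at-high refl e | at-high refl f rewrite e | f = refl
  ... | at-high refl e | away v≢A _ f rewrite e | f = sym (<-suc-avoiding v≢A)
  ... | away _ u≢1+A e | at-low  refl f rewrite e | f = suc-<-avoiding u≢1+A
  ... | away _ u≢1+A e | at-high refl f rewrite e | f = sym (suc-<-avoiding u≢1+A)
  ... | away _ _ e     | away _ _ f rewrite e | f = refl

  pair-≡ᵇ-true : ∀ {u v p q} → u ≡ p × v ≡ q → ((u ≡ᵇ p) ∧ (v ≡ᵇ q)) ≡ true
  pair-≡ᵇ-true {u} {v} {p} {q} = dec-true (u ≟ p ×-dec v ≟ q)

  pair-≡ᵇ-false : ∀ {u v p q} → ¬ (u ≡ p × v ≡ q) → ((u ≡ᵇ p) ∧ (v ≡ᵇ q)) ≡ false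
  pair-≡ᵇ-false {u} {v} {p} {q} = dec-false (u ≟ p ×-dec v ≟ q)

  adjSwap-descent : ∀ A u v →
    𝟙 (adjSwap A v <ᵇ adjSwap A u) + 𝟙 ((u ≡ᵇ suc A) ∧ (v ≡ᵇ A)) ≡ 𝟙 (v <ᵇ u) + 𝟙 ((u ≡ᵇ A) ∧ (v ≡ᵇ suc A))
  adjSwap-descent A u v with u ≟ A ×-dec v ≟ suc A | u ≟ suc A ×-dec v ≟ A
  ... | yes (refl , refl) | _
    rewrite adjSwap-low A | adjSwap-high A | <ᵇ-true (n<1+n A) | <ᵇ-false (<⇒≯ (n<1+n A))
          | pair-≡ᵇ-true {A} {suc A} (refl , refl) | pair-≡ᵇ-false {A} {suc A} {suc A} {A} (1+n≢n ∘ sym ∘ proj₁) = refl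
  ... | no _ | yes (refl , refl)
    rewrite adjSwap-low A | adjSwap-high A | <ᵇ-true (n<1+n A) | <ᵇ-false (<⇒≯ (n<1+n A))
          | pair-≡ᵇ-true {suc A} {A} (refl , refl) | pair-≡ᵇ-false {suc A} {A} {A} {suc A} (1+n≢n ∘ proj₁) = refl
  ... | no ¬lh | no ¬hl rewrite pair-≡ᵇ-false ¬lh | pair-≡ᵇ-false ¬hl | adjSwap-<ᵇ A u v ¬lh ¬hl = refl

  +-interchange-cong : ∀ a c {b d e f g h} → a + b ≡ c + d → e + f ≡ g + h →
                       (a + e) + (b + f) ≡ (c + g) + (d + h)
  +-interchange-cong a c {b} {d} {e} {f} {g} {h} p q =
    trans (+-interchange a e b f) (trans (cong₂ _+_ p q) (sym (+-interchange c g d h)))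

  module _ {n : ℕ} where

    _is_ : Fin n → ℕ → Bool
    x is p = toℕ x ≡ᵇ p

    descent : Fin n → Fin n → ℕ
    descent x y = 𝟙 (toℕ y <ᵇ toℕ x)

    isPair : ℕ → ℕ → Fin n → Fin n → ℕ
    isPair p q x y = 𝟙 ((x is p) ∧ (y is q))

    adjacencies : ℕ → ℕ → List (Fin n) → ℕ
    adjacencies p q []           = 0
    adjacencies p q (x ∷ [])     = 0
    adjacencies p q (x ∷ y ∷ ys) = isPair p q x y + adjacencies p q (y ∷ ys)

    precedences : ℕ → ℕ → List (Fin n) → ℕ
    precedences p q []       = 0
    precedences p q (x ∷ xs) = sum (map (isPair p q x) xs) + precedences p q xs

  Unique⇒lookup-injective : ∀ {X : Set} {w : List X} → Unique w → Injective _≡_ _≡_ (lookup w)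
  Unique⇒lookup-injective {w = x ∷ xs} (x∉xs ∷ u) {Fin.zero}  {Fin.zero}  _ = refl
  Unique⇒lookup-injective {w = x ∷ xs} (x∉xs ∷ u) {Fin.zero}  {Fin.suc j} e = ⊥-elim (All.lookup x∉xs (∈-lookup j) e)
  Unique⇒lookup-injective {w = x ∷ xs} (x∉xs ∷ u) {Fin.suc i} {Fin.zero}  e = ⊥-elim (All.lookup x∉xs (∈-lookup i) (sym e))
  Unique⇒lookup-injective {w = x ∷ xs} (x∉xs ∷ u) {Fin.suc i} {Fin.suc j} e = cong Fin.suc (Unique⇒lookup-injective u e)

  Unique⇒complete : ∀ {n} (w : List (Fin n)) → Unique w → length w ≡ n → ∀ x → x ∈ w
  Unique⇒complete {suc k} w u len x with any? (x ≟ᶠ_) w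
  ... | yes x∈w = x∈w
  ... | no  x∉w = ⊥-elim (<⇒notInjective k<len squeeze-injective)
    where
    k<len : k < length w
    k<len = subst (k <_) (sym len) (n<1+n k)
    avoids : ∀ i → x ≢ lookup w i
    avoids i x≡wᵢ = x∉w (subst (_∈ w) (sym x≡wᵢ) (∈-lookup i))
    squeeze-injective : Injective _≡_ _≡_ (λ i → punchOut (avoids i))
    squeeze-injective e = Unique⇒lookup-injective u (punchOut-injective (avoids _) (avoids _) e)

  words-length : ∀ n k → All (λ w → length w ≡ k) (words n k)
  words-length n zero    = refl ∷ []
  words-length n (suc k) =
    concat⁺ (map⁺ {xs = allFin n} (All.tabulate λ {a} _ → map⁺ {f = a ∷_} (All.map (cong suc) (words-length n k))))

  perms-complete : ∀ n → All (λ w → Unique w × (∀ x → x ∈ w)) (perms n)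
  perms-complete n = All.map (λ (u , len) → u , Unique⇒complete _ u len)
    (All.zip (all-filter (UniqueDec.unique? _≟ᶠ_) (words n n) , filter⁺ (UniqueDec.unique? _≟ᶠ_) (words-length n n)))

  data AtMostOne : ℕ → ℕ → Set where
    first   : AtMostOne 1 0
    second  : AtMostOne 0 1
    neither : AtMostOne 0 0

  data ExactlyOne : ℕ → ℕ → Set where
    first  : ExactlyOne 1 0
    second : ExactlyOne 0 1

  sum-map-zero : ∀ {X : Set} {f : X → ℕ} {xs} → All (λ x → f x ≡ 0) xs → sum (map f xs) ≡ 0
  sum-map-zero []       = refl
  sum-map-zero (e ∷ es) = cong₂ _+_ e (sum-map-zero es)

  module _ {n : ℕ} where

    Absent : ℕ → List (Fin n) → Set
    Absent p = All (λ y → toℕ y ≢ p)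

    Present : ℕ → List (Fin n) → Set
    Present p = Any (λ y → toℕ y ≡ p)

    absent-after : ∀ {x : Fin n} {xs p} → toℕ x ≡ p → All (x ≢_) xs → Absent p xs
    absent-after x≡p = All.map (λ x≢y y≡p → x≢y (toℕ-injective (trans x≡p (sym y≡p))))

    isPair-1 : ∀ {p q} (x y : Fin n) → toℕ x ≡ p → toℕ y ≡ q → isPair p q x y ≡ 1
    isPair-1 _ _ x≡p y≡q = cong 𝟙 (pair-≡ᵇ-true (x≡p , y≡q))

    isPair-0 : ∀ {p q} (x y : Fin n) → ¬ (toℕ x ≡ p × toℕ y ≡ q) → isPair p q x y ≡ 0
    isPair-0 _ _ ¬pair = cong 𝟙 (pair-≡ᵇ-false ¬pair)

    adjacencies-absent : ∀ {p q} {w : List (Fin n)} → Absent p w → adjacencies p q w ≡ 0 × adjacencies q p w ≡ 0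
    adjacencies-absent {w = []}         _ = refl , refl
    adjacencies-absent {w = x ∷ []}     _ = refl , refl
    adjacencies-absent {w = x ∷ y ∷ ys} (x≢p ∷ y≢p ∷ ys-absent) =
      let (pq≡0 , qp≡0) = adjacencies-absent (y≢p ∷ ys-absent)
      in cong₂ _+_ (isPair-0 x y (x≢p ∘ proj₁)) pq≡0 , cong₂ _+_ (isPair-0 x y (y≢p ∘ proj₂)) qp≡0

    adjacencies-at-head : ∀ {p q} {x y : Fin n} {ys} → p ≢ q → toℕ x ≡ p → toℕ y ≡ q → Unique (x ∷ y ∷ ys) →
                      adjacencies p q (x ∷ y ∷ ys) ≡ 1 × adjacencies q p (x ∷ y ∷ ys) ≡ 0
    adjacencies-at-head {x = x} {y} p≢q x≡p y≡q (x∉ ∷ _) =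
      let (pq≡0 , qp≡0) = adjacencies-absent (absent-after x≡p x∉)
      in cong₂ _+_ (isPair-1 x y x≡p y≡q) pq≡0 , cong₂ _+_ (isPair-0 x y (p≢q ∘ trans (sym x≡p) ∘ proj₁)) qp≡0

    adjacencies-unique : ∀ {p q} → p ≢ q → (w : List (Fin n)) → Unique w →
                         AtMostOne (adjacencies p q w) (adjacencies q p w)
    adjacencies-unique p≢q []       _ = neither
    adjacencies-unique p≢q (x ∷ []) _ = neither
    adjacencies-unique {p} {q} p≢q (x ∷ y ∷ ys) u@(_ ∷ u′)
      with toℕ x ≟ p ×-dec toℕ y ≟ q | toℕ x ≟ q ×-dec toℕ y ≟ p
    ... | yes (x≡p , y≡q) | _ =
      let (pq≡1 , qp≡0) = adjacencies-at-head p≢q x≡p y≡q u in subst₂ AtMostOne (sym pq≡1) (sym qp≡0) first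
    ... | no _ | yes (x≡q , y≡p) =
      let (qp≡1 , pq≡0) = adjacencies-at-head (p≢q ∘ sym) x≡q y≡p u in subst₂ AtMostOne (sym pq≡0) (sym qp≡1) second
    ... | no ¬pq | no ¬qp =
      subst₂ AtMostOne (sym (cong (_+ adjacencies p q (y ∷ ys)) (isPair-0 x y ¬pq)))
                       (sym (cong (_+ adjacencies q p (y ∷ ys)) (isPair-0 x y ¬qp)))
        (adjacencies-unique p≢q (y ∷ ys) u′)

    pairsFrom-other : ∀ {p} q {x : Fin n} ys → toℕ x ≢ p → sum (map (isPair p q x) ys) ≡ 0
    pairsFrom-other q {x} ys x≢p = sum-map-zero (All.tabulate {xs = ys} λ {y} _ → isPair-0 x y (x≢p ∘ proj₁))

    pairsFrom-once : ∀ {p q} {x : Fin n} {ys} → toℕ x ≡ p → Unique ys → Present q ys →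
                     sum (map (isPair p q x) ys) ≡ 1
    pairsFrom-once {q = q} {x} {y ∷ ys} x≡p (y∉ ∷ u) q∈ with toℕ y ≟ q
    ... | yes y≡q = cong₂ _+_ (isPair-1 x y x≡p y≡q)
                      (sum-map-zero {f = isPair _ q x} (All.map (λ {z} z≢q → isPair-0 x z (z≢q ∘ proj₂)) (absent-after y≡q y∉)))
    ... | no y≢q  = cong₂ _+_ (isPair-0 x y (y≢q ∘ proj₂)) (pairsFrom-once x≡p u (Any.tail y≢q q∈))

    precedences-absent : ∀ {p q} {w : List (Fin n)} → Absent p w → precedences p q w ≡ 0 × precedences q p w ≡ 0
    precedences-absent {w = []}     _ = refl , refl
    precedences-absent {p} {q} {x ∷ xs} (x≢p ∷ xs-absent) =
      let (pq≡0 , qp≡0) = precedences-absent xs-absent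
      in cong₂ _+_ (pairsFrom-other q xs x≢p) pq≡0 ,
         cong₂ _+_ (sum-map-zero {f = isPair q p x} (All.map (λ {y} y≢p → isPair-0 x y (y≢p ∘ proj₂)) xs-absent)) qp≡0

    precedences-at-head : ∀ {p q} {x : Fin n} {xs} → p ≢ q → toℕ x ≡ p → Unique (x ∷ xs) → Present q xs →
                      precedences p q (x ∷ xs) ≡ 1 × precedences q p (x ∷ xs) ≡ 0
    precedences-at-head {p} {q} {x} {xs} p≢q x≡p (x∉ ∷ u) q∈ =
      let (pq≡0 , qp≡0) = precedences-absent (absent-after x≡p x∉)
      in cong₂ _+_ (pairsFrom-once x≡p u q∈) pq≡0 ,
         cong₂ _+_ (pairsFrom-other p xs (p≢q ∘ trans (sym x≡p))) qp≡0

    precedences-unique : ∀ {p q} → p ≢ q → (w : List (Fin n)) → Unique w → Present p w → Present q w →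
                         ExactlyOne (precedences p q w) (precedences q p w)
    precedences-unique {p} {q} p≢q (x ∷ xs) u@(_ ∷ u′) p∈ q∈ with toℕ x ≟ p | toℕ x ≟ q
    ... | yes x≡p | _ =
      let (pq≡1 , qp≡0) = precedences-at-head p≢q x≡p u (Any.tail (p≢q ∘ trans (sym x≡p)) q∈)
      in subst₂ ExactlyOne (sym pq≡1) (sym qp≡0) first
    ... | no _ | yes x≡q =
      let (qp≡1 , pq≡0) = precedences-at-head (p≢q ∘ sym) x≡q u (Any.tail (p≢q ∘ sym ∘ trans (sym x≡q)) p∈)
      in subst₂ ExactlyOne (sym pq≡0) (sym qp≡1) second
    ... | no x≢p | no x≢q =
      subst₂ ExactlyOne
        (sym (cong (_+ precedences p q xs) (pairsFrom-other q xs x≢p)))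
        (sym (cong (_+ precedences q p xs) (pairsFrom-other p xs x≢q)))
        (precedences-unique p≢q xs u′ (Any.tail x≢p p∈) (Any.tail x≢q q∈))

  even? : ℕ → Bool
  even? k = (k % 2) ≡ᵇ 0

  even?-suc : ∀ k → even? (suc k) ≡ not (even? k)
  even?-suc zero          = refl
  even?-suc (suc zero)    = refl
  even?-suc (suc (suc k)) = trans (cong (_≡ᵇ 0) (%2-suc-suc (suc k)))
                                  (trans (even?-suc k) (cong (λ r → not (r ≡ᵇ 0)) (sym (%2-suc-suc k))))
    where
    %2-suc-suc : ∀ m → suc (suc m) % 2 ≡ m % 2
    %2-suc-suc m = trans (cong (_% 2) (+-comm 2 m)) ([m+n]%n≡m%n m 2)

  module _ {n : ℕ} where

    sign : List (Fin n) → ℤ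
    sign w = if isEven w then 1ℤ else -1ℤ

    sign-suc : ∀ (v w : List (Fin n)) → inv v ≡ suc (inv w) → sign v ≡ - sign w
    sign-suc v w e with isEven w | trans (cong even? e) (even?-suc (inv w))
    ... | true  | v-odd  rewrite v-odd  = refl
    ... | false | v-even rewrite v-even = refl

    sign-antisymmetric : ∀ (v w : List (Fin n)) {a b} → ExactlyOne a b → inv v + b ≡ inv w + a → sign v ≡ - sign w
    sign-antisymmetric v w first e = sign-suc v w (trans (sym (+-identityʳ (inv v))) (trans e (+-comm (inv w) 1)))
    sign-antisymmetric v w second e =
      trans (sym (ℤP.neg-involutive (sign v)))
            (cong -_ (sym (sign-suc w v (trans (sym (+-identityʳ (inv w))) (trans (sym e) (+-comm (inv v) 1))))))

  module AdjacentTransposition {n : ℕ} (a b : Fin n) (b≡1+a : toℕ b ≡ suc (toℕ a)) where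

    A B : ℕ
    A = toℕ a
    B = suc A

    τ : Permutation′ n
    τ = transpose a b

    τ⟨_⟩ : Fin n → Fin n
    τ⟨ x ⟩ = τ ⟨$⟩ʳ x

    toℕ-τ : ∀ x → toℕ τ⟨ x ⟩ ≡ adjSwap A (toℕ x)
    toℕ-τ x with x ≟ᶠ a
    ... | yes refl = trans b≡1+a (sym (adjSwap-low A))
    ... | no x≢a with x ≟ᶠ b
    ...   | yes refl = trans (sym (adjSwap-high A)) (cong (adjSwap A) (sym b≡1+a))
    ...   | no x≢b with adjSwap-view A (toℕ x)
    ...     | at-low  x≡A _ = ⊥-elim (x≢a (toℕ-injective x≡A))
    ...     | at-high x≡B _ = ⊥-elim (x≢b (toℕ-injective (trans x≡B (sym b≡1+a))))
    ...     | away _ _ e    = sym e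

    descent-τ : ∀ x y → descent τ⟨ x ⟩ τ⟨ y ⟩ + isPair B A x y ≡ descent x y + isPair A B x y
    descent-τ x y rewrite toℕ-τ x | toℕ-τ y = adjSwap-descent A (toℕ x) (toℕ y)

    des-τ : ∀ w → des (map τ⟨_⟩ w) + adjacencies B A w ≡ des w + adjacencies A B w
    des-τ []           = refl
    des-τ (x ∷ [])     = refl
    des-τ (x ∷ y ∷ ys) = +-interchange-cong (descent τ⟨ x ⟩ τ⟨ y ⟩) (descent x y) (descent-τ x y) (des-τ (y ∷ ys))

    inversionsFrom-τ : ∀ x ys →
      sum (map (descent τ⟨ x ⟩) (map τ⟨_⟩ ys)) + sum (map (isPair B A x) ys)
      ≡ sum (map (descent x) ys) + sum (map (isPair A B x) ys)
    inversionsFrom-τ x []       = refl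
    inversionsFrom-τ x (y ∷ ys) = +-interchange-cong (descent τ⟨ x ⟩ τ⟨ y ⟩) (descent x y) (descent-τ x y) (inversionsFrom-τ x ys)

    inv-τ : ∀ w → inv (map τ⟨_⟩ w) + precedences B A w ≡ inv w + precedences A B w
    inv-τ []       = refl
    inv-τ (x ∷ xs) =
      +-interchange-cong (sum (map (descent τ⟨ x ⟩) (map τ⟨_⟩ xs))) (sum (map (descent x) xs))
        (inversionsFrom-τ x xs) (inv-τ xs)

    is-τ : ∀ x p → (τ⟨ x ⟩ is p) ≡ (x is adjSwap A p)
    is-τ x p = trans (cong (_≡ᵇ p) (toℕ-τ x)) (adjSwap-≡ᵇ A (toℕ x) p)

    adjacencies-τ : ∀ p q w → adjacencies p q (map τ⟨_⟩ w) ≡ adjacencies (adjSwap A p) (adjSwap A q) w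
    adjacencies-τ p q []           = refl
    adjacencies-τ p q (x ∷ [])     = refl
    adjacencies-τ p q (x ∷ y ∷ ys) =
      cong₂ _+_ (cong₂ (λ s t → 𝟙 (s ∧ t)) (is-τ x p) (is-τ y q)) (adjacencies-τ p q (y ∷ ys))

    present-a : ∀ {w} → a ∈ w → Present A w
    present-a = Any.map (λ a≡y → cong toℕ (sym a≡y))

    present-b : ∀ {w} → b ∈ w → Present B w
    present-b = Any.map (λ b≡y → trans (cong toℕ (sym b≡y)) b≡1+a)

    sign-τ : ∀ w → Unique w → a ∈ w → b ∈ w → sign (map τ⟨_⟩ w) ≡ - sign w
    sign-τ w u a∈w b∈w = sign-antisymmetric (map τ⟨_⟩ w) w
      (precedences-unique (1+n≢n ∘ sym) w u (present-a a∈w) (present-b b∈w))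
      (inv-τ w)


module _ where

  open import Data.Integer using (+_; _+_; _-_; _*_)
  open import Data.Integer.Tactic.RingSolver using (solve-∀)
  import Data.Nat as ℕ
  import Data.Nat.Properties as ℕP
  open import Data.Sum using (inj₁; inj₂)
  open import Data.Nat.DivMod using (_/_; m/n*n≤m)
  open import Algebra.Properties.CommutativeSemigroup ℤP.+-commutativeSemigroup using (interchange)
  open import Algebra.Properties.CommutativeMonoid.Sum ℤP.+-0-commutativeMonoid using (sum-permute) renaming (sum to ∑ℤ)

  -- Sums over permutations

  ∑ : {X : Set} → List X → (X → ℤ) → ℤ
  ∑ []       f = 0ℤ
  ∑ (x ∷ xs) f = f x + ∑ xs f

  infix 5 ∑
  syntax ∑ xs (λ x → e) = ∑[ x ∈ xs ] e

  module _ {X : Set} where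

    ∑-cong : ∀ {f g : X → ℤ} → (∀ x → f x ≡ g x) → ∀ xs → ∑ xs f ≡ ∑ xs g
    ∑-cong f≗g []       = refl
    ∑-cong f≗g (x ∷ xs) = cong₂ _+_ (f≗g x) (∑-cong f≗g xs)

    ∑-cong-All : ∀ {f g : X → ℤ} {xs} → All (λ x → f x ≡ g x) xs → ∑ xs f ≡ ∑ xs g
    ∑-cong-All []       = refl
    ∑-cong-All (e ∷ es) = cong₂ _+_ e (∑-cong-All es)

    ∑-zero : ∀ (xs : List X) → ∑[ x ∈ xs ] 0ℤ ≡ 0ℤ
    ∑-zero []       = refl
    ∑-zero (x ∷ xs) = trans (ℤP.+-identityˡ _) (∑-zero xs)

    ∑-+ : ∀ (f g : X → ℤ) xs → ∑[ x ∈ xs ] (f x + g x) ≡ ∑ xs f + ∑ xs g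
    ∑-+ f g []       = refl
    ∑-+ f g (x ∷ xs) = trans (cong (_+_ (f x + g x)) (∑-+ f g xs)) (interchange (f x) (g x) (∑ xs f) (∑ xs g))

    ∑-++ : ∀ (f : X → ℤ) xs ys → ∑ (xs ++ ys) f ≡ ∑ xs f + ∑ ys f
    ∑-++ f []       ys = sym (ℤP.+-identityˡ _)
    ∑-++ f (x ∷ xs) ys = trans (cong (_+_ (f x)) (∑-++ f xs ys)) (sym (ℤP.+-assoc (f x) _ _))

    ∑-filter : ∀ {P : X → Set} (P? : Decidable P) (f : X → ℤ) xs →
               ∑ (filter P? xs) f ≡ ∑[ x ∈ xs ] (if does (P? x) then f x else 0ℤ)
    ∑-filter P? f []       = refl
    ∑-filter P? f (x ∷ xs) with does (P? x)
    ... | true  = cong (_+_ (f x)) (∑-filter P? f xs)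
    ... | false = trans (∑-filter P? f xs) (sym (ℤP.+-identityˡ _))

  module _ {X Y : Set} where

    ∑-map : ∀ (f : Y → ℤ) (g : X → Y) xs → ∑ (map g xs) f ≡ ∑ xs (f ∘ g)
    ∑-map f g []       = refl
    ∑-map f g (x ∷ xs) = cong (_+_ (f (g x))) (∑-map f g xs)

    ∑-concatMap : ∀ (f : Y → ℤ) (h : X → List Y) xs → ∑ (concatMap h xs) f ≡ ∑[ x ∈ xs ] ∑ (h x) f
    ∑-concatMap f h []       = refl
    ∑-concatMap f h (x ∷ xs) = trans (∑-++ f (h x) (concatMap h xs)) (cong (_+_ (∑ (h x) f)) (∑-concatMap f h xs))

  ∑-tabulate : ∀ {m} {X : Set} (h : Fin m → X) (f : X → ℤ) → ∑ (tabulate h) f ≡ ∑ℤ (f ∘ h)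
  ∑-tabulate {zero}  h f = refl
  ∑-tabulate {suc m} h f = cong (_+_ (f (h Fin.zero))) (∑-tabulate (h ∘ Fin.suc) f)

  module _ {n : ℕ} (π : Permutation′ n) where

    open ≡-Reasoning

    private
      π⟨_⟩ : Fin n → Fin n
      π⟨ x ⟩ = π ⟨$⟩ʳ x

      unique? : ∀ (w : List (Fin n)) → Dec (Unique w)
      unique? = UniqueDec.unique? _≟ᶠ_

    ∑-allFin-permute : ∀ (f : Fin n → ℤ) → ∑[ i ∈ allFin n ] f π⟨ i ⟩ ≡ ∑ (allFin n) f
    ∑-allFin-permute f = begin
      ∑[ i ∈ allFin n ] f π⟨ i ⟩ ≡⟨ ∑-tabulate id (f ∘ π⟨_⟩) ⟩
      ∑ℤ (f ∘ π⟨_⟩)               ≡⟨ sym (sum-permute f π) ⟩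
      ∑ℤ f                        ≡⟨ sym (∑-tabulate id f) ⟩
      ∑ (allFin n) f              ∎

    ∑-words-permute : ∀ k (G : List (Fin n) → ℤ) → ∑[ w ∈ words n k ] G (map π⟨_⟩ w) ≡ ∑ (words n k) G
    ∑-words-permute zero    G = refl
    ∑-words-permute (suc k) G = begin
      ∑[ w ∈ words n (suc k) ] G (map π⟨_⟩ w)                ≡⟨ ∑-concatMap (G ∘ map π⟨_⟩) extend (allFin n) ⟩
      ∑[ a ∈ allFin n ] ∑[ w ∈ extend a ] G (map π⟨_⟩ w)     ≡⟨ ∑-cong (λ a → ∑-map (G ∘ map π⟨_⟩) (a ∷_) W) (allFin n) ⟩
      ∑[ a ∈ allFin n ] ∑[ w ∈ W ] G (π⟨ a ⟩ ∷ map π⟨_⟩ w)   ≡⟨ ∑-cong (λ a → ∑-words-permute k (G ∘ (π⟨ a ⟩ ∷_))) (allFin n) ⟩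
      ∑[ a ∈ allFin n ] ∑[ w ∈ W ] G (π⟨ a ⟩ ∷ w)            ≡⟨ ∑-allFin-permute (λ b → ∑[ w ∈ W ] G (b ∷ w)) ⟩
      ∑[ a ∈ allFin n ] ∑[ w ∈ W ] G (a ∷ w)                 ≡⟨ ∑-cong (λ a → sym (∑-map G (a ∷_) W)) (allFin n) ⟩
      ∑[ a ∈ allFin n ] ∑ (extend a) G                       ≡⟨ sym (∑-concatMap G extend (allFin n)) ⟩
      ∑ (words n (suc k)) G                                  ∎
      where
      W = words n k
      extend : Fin n → List (List (Fin n))
      extend a = map (a ∷_) W

    unique?-permute : ∀ w → does (unique? (map π⟨_⟩ w)) ≡ does (unique? w)
    unique?-permute w = does-⇔ (mk⇔ (Unique.map⁻ {f = π⟨_⟩}) (Unique.map⁺ (Injection.injective (↔⇒↣ π))))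
                                 (unique? (map π⟨_⟩ w)) (unique? w)

    ∑-perms-permute : ∀ (F : List (Fin n) → ℤ) → ∑[ w ∈ perms n ] F (map π⟨_⟩ w) ≡ ∑ (perms n) F
    ∑-perms-permute F = begin
      ∑[ w ∈ perms n ] F (map π⟨_⟩ w)                                       ≡⟨ ∑-filter unique? (F ∘ map π⟨_⟩) (words n n) ⟩
      ∑[ w ∈ words n n ] (if does (unique? w) then F (map π⟨_⟩ w) else 0ℤ)  ≡⟨ ∑-cong restrict (words n n) ⟩
      ∑[ w ∈ words n n ] F′ (map π⟨_⟩ w)                                    ≡⟨ ∑-words-permute n F′ ⟩
      ∑ (words n n) F′                                                      ≡⟨ sym (∑-filter unique? F (words n n)) ⟩
      ∑ (perms n) F                                                         ∎
      where
      F′ : List (Fin n) → ℤ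
      F′ w = if does (unique? w) then F w else 0ℤ
      restrict : ∀ w → (if does (unique? w) then F (map π⟨_⟩ w) else 0ℤ) ≡ F′ (map π⟨_⟩ w)
      restrict w = cong (if_then F (map π⟨_⟩ w) else 0ℤ) (sym (unique?-permute w))

    ∑-perms-pairing : ∀ (F H : List (Fin n) → ℤ) →
      All (λ w → F w + F (map π⟨_⟩ w) ≡ H w + H (map π⟨_⟩ w)) (perms n) →
      ∑ (perms n) F ≡ ∑ (perms n) H
    ∑-perms-pairing F H pairs = +-double-injective (begin
      ∑ (perms n) F + ∑ (perms n) F                  ≡⟨ cong (_+_ (∑ (perms n) F)) (sym (∑-perms-permute F)) ⟩
      ∑ (perms n) F + (∑[ w ∈ perms n ] F (map π⟨_⟩ w)) ≡⟨ sym (∑-+ F (F ∘ map π⟨_⟩) (perms n)) ⟩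
      ∑[ w ∈ perms n ] (F w + F (map π⟨_⟩ w))      ≡⟨ ∑-cong-All pairs ⟩
      ∑[ w ∈ perms n ] (H w + H (map π⟨_⟩ w))      ≡⟨ ∑-+ H (H ∘ map π⟨_⟩) (perms n) ⟩
      ∑ (perms n) H + (∑[ w ∈ perms n ] H (map π⟨_⟩ w)) ≡⟨ cong (_+_ (∑ (perms n) H)) (∑-perms-permute H) ⟩
      ∑ (perms n) H + ∑ (perms n) H                  ∎)
      where
      +-double-injective : ∀ {x y} → x + x ≡ y + y → x ≡ y
      +-double-injective {x} {y} e = ℤP.*-cancelˡ-≡ (+ 2) x y (trans (double x) (trans e (sym (double y))))
        where
        double : ∀ z → + 2 * z ≡ z + z
        double = solve-∀

  -- Finite differences

  Δ : (ℕ → ℤ) → ℕ → ℤ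
  Δ g x = g x - g (suc x)

  Δ^ : ℕ → (ℕ → ℤ) → ℕ → ℤ
  Δ^ zero    g = g
  Δ^ (suc m) g = Δ (Δ^ m g)

  Δ^-cong : ∀ m {f g : ℕ → ℤ} → f ≗ g → Δ^ m f ≗ Δ^ m g
  Δ^-cong zero    f≗g x = f≗g x
  Δ^-cong (suc m) f≗g x = cong₂ _-_ (Δ^-cong m f≗g x) (Δ^-cong m f≗g (suc x))

  Δ^-linear : ∀ m (f g : ℕ → ℤ) x → Δ^ m (λ y → f y - g y) x ≡ Δ^ m f x - Δ^ m g x
  Δ^-linear zero    f g x = refl
  Δ^-linear (suc m) f g x = trans (cong₂ _-_ (Δ^-linear m f g x) (Δ^-linear m f g (suc x)))
                             (minus-interchange (Δ^ m f x) (Δ^ m g x) (Δ^ m f (suc x)) (Δ^ m g (suc x)))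
    where
    minus-interchange : ∀ a b c d → (a - b) - (c - d) ≡ (a - c) - (b - d)
    minus-interchange = solve-∀

  Δ^-shift : ∀ m (g : ℕ → ℤ) x → Δ^ m (g ∘ suc) x ≡ Δ^ m g (suc x)
  Δ^-shift zero    g x = refl
  Δ^-shift (suc m) g x = cong₂ _-_ (Δ^-shift m g x) (Δ^-shift m g (suc x))

  Δ^-Δ : ∀ m (g : ℕ → ℤ) x → Δ^ m (Δ g) x ≡ Δ^ (suc m) g x
  Δ^-Δ zero    g x = refl
  Δ^-Δ (suc m) g x = cong₂ _-_ (Δ^-Δ m g x) (Δ^-Δ m g (suc x))

  Δ-linear-factor : ∀ (c : ℤ) (g : ℕ → ℤ) x →
                    Δ (λ y → (+ y + c) * g y) x ≡ (+ x + c) * Δ g x - g (suc x)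
  Δ-linear-factor c g x =
    trans (cong (λ z → (+ x + c) * g x - (z + c) * g (suc x)) (ℤP.pos-+ 1 x))
          (product-rule (+ x) c (g x) (g (suc x)))
    where
    product-rule : ∀ y c u v → (y + c) * u - ((+ 1 + y) + c) * v ≡ (y + c) * (u - v) - v
    product-rule = solve-∀

  Δ^-linear-factor : ∀ m (c : ℤ) (g : ℕ → ℤ) → (∀ x → Δ^ m g x ≡ 0ℤ) →
                     ∀ x → Δ^ (suc m) (λ y → (+ y + c) * g y) x ≡ 0ℤ
  Δ^-linear-factor zero c g g≗0 x
    rewrite g≗0 x | g≗0 (suc x) | ℤP.*-zeroʳ (+ x + c) | ℤP.*-zeroʳ (+ suc x + c) = refl
  Δ^-linear-factor (suc m) c g Δᵐ⁺¹g≗0 x = begin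
    Δ^ (suc (suc m)) (λ y → (+ y + c) * g y) x                          ≡⟨ sym (Δ^-Δ (suc m) _ x) ⟩
    Δ^ (suc m) (Δ (λ y → (+ y + c) * g y)) x                            ≡⟨ Δ^-cong (suc m) (Δ-linear-factor c g) x ⟩
    Δ^ (suc m) (λ y → (+ y + c) * Δ g y - g (suc y)) x                  ≡⟨ Δ^-linear (suc m) _ (g ∘ suc) x ⟩
    Δ^ (suc m) (λ y → (+ y + c) * Δ g y) x - Δ^ (suc m) (g ∘ suc) x     ≡⟨ cong₂ _-_ factor-part shift-part ⟩
    0ℤ                                                                   ∎
    where
    open ≡-Reasoning
    factor-part : Δ^ (suc m) (λ y → (+ y + c) * Δ g y) x ≡ 0ℤ
    factor-part = Δ^-linear-factor m c (Δ g) (λ y → trans (Δ^-Δ m g y) (Δᵐ⁺¹g≗0 y)) x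
    shift-part : Δ^ (suc m) (g ∘ suc) x ≡ 0ℤ
    shift-part = trans (Δ^-shift (suc m) g x) (Δᵐ⁺¹g≗0 (suc x))

  power : ℕ → ℕ → ℤ
  power r d = + ((d ℕ.+ 1) ℕ.^ r)

  Δ^-power : ∀ r x → Δ^ (suc r) (power r) x ≡ 0ℤ
  Δ^-power zero    x = refl
  Δ^-power (suc r) x =
    trans (Δ^-cong (suc (suc r)) power-suc x) (Δ^-linear-factor (suc r) 1ℤ (power r) (Δ^-power r) x)
    where
    power-suc : ∀ y → power (suc r) y ≡ (+ y + 1ℤ) * power r y
    power-suc y = trans (ℤP.pos-* (y ℕ.+ 1) ((y ℕ.+ 1) ℕ.^ r)) (cong (_* power r y) (ℤP.pos-+ y 1))

  Δ^-power-above : ∀ {r m} → r < m → ∀ x → Δ^ m (power r) x ≡ 0ℤ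
  Δ^-power-above {r} {suc m} r<1+m x with ℕP.m<1+n⇒m<n∨m≡n r<1+m
  ... | inj₁ r<m  = cong₂ _-_ (Δ^-power-above r<m x) (Δ^-power-above r<m (suc x))
  ... | inj₂ refl = Δ^-power r x

  -- The pairing argument

  difference-by-Δ : ∀ (G : ℕ → ℤ) {d d′ α β} → AtMostOne α β → d′ ℕ.+ β ≡ d ℕ.+ α →
             G d - G d′ ≡ + α * Δ G d - + β * Δ G d′
  difference-by-Δ G {d} {d′} first e
    rewrite trans (sym (ℕP.+-identityʳ d′)) (trans e (ℕP.+-comm d 1)) = up (G d) (G (suc d)) (G (suc (suc d)))
    where
    up : ∀ x y z → x - y ≡ + 1 * (x - y) - + 0 * (y - z)
    up = solve-∀
  difference-by-Δ G {d} {d′} second e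
    rewrite trans (sym (ℕP.+-identityʳ d)) (trans (sym e) (ℕP.+-comm d′ 1)) = down (G d′) (G (suc d′)) (G (suc (suc d′)))
    where
    down : ∀ x y z → y - x ≡ + 0 * (y - z) - + 1 * (x - y)
    down = solve-∀
  difference-by-Δ G {d} {d′} neither e
    rewrite trans (sym (ℕP.+-identityʳ d′)) (trans e (ℕP.+-identityʳ d)) = level (G d) (G (suc d))
    where
    level : ∀ x y → x - x ≡ + 0 * (x - y) - + 0 * (x - y)
    level = solve-∀

  adjacencyProduct : ∀ {n} → ℕ → List (Fin n) → ℤ
  adjacencyProduct zero    w = 1ℤ
  adjacencyProduct (suc j) w = adjacencyProduct j w * + adjacencies (2 ℕ.* j) (suc (2 ℕ.* j)) w

  module PairingStep {n : ℕ} (a b : Fin n) (b≡1+a : toℕ b ≡ suc (toℕ a)) where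

    open AdjacentTransposition a b b≡1+a

    adjacencies-τ-swapped : ∀ w → adjacencies A B (map τ⟨_⟩ w) ≡ adjacencies B A w
    adjacencies-τ-swapped w =
      trans (adjacencies-τ A B w) (cong₂ (λ p q → adjacencies p q w) (adjSwap-low A) (adjSwap-high A))

    adjacencyProduct-τ : ∀ j → 2 ℕ.* j ℕ.≤ A → ∀ w → adjacencyProduct j (map τ⟨_⟩ w) ≡ adjacencyProduct j w
    adjacencyProduct-τ zero    _      w = refl
    adjacencyProduct-τ (suc j) 2+2j≤A w =
      cong₂ _*_ (adjacencyProduct-τ j (ℕP.≤-trans (ℕP.n≤1+n _) (ℕP.<⇒≤ 1+2j<A)) w)
                (cong +_ (trans (adjacencies-τ _ _ w)
                                (cong₂ (λ p q → adjacencies p q w) (adjSwap-below 2j<A) (adjSwap-below 1+2j<A))))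
      where
      1+2j<A : suc (2 ℕ.* j) < A
      1+2j<A = subst (ℕ._≤ A) (ℕP.*-suc 2 j) 2+2j≤A
      2j<A : 2 ℕ.* j < A
      2j<A = ℕP.<-trans (ℕP.n<1+n _) 1+2j<A

    signed-sum-step : ∀ (wt : List (Fin n) → ℤ) → (∀ w → wt (map τ⟨_⟩ w) ≡ wt w) → (G : ℕ → ℤ) →
      ∑[ w ∈ perms n ] sign w * wt w * G (des w) ≡
      ∑[ w ∈ perms n ] sign w * (wt w * + adjacencies A B w) * Δ G (des w)
    signed-sum-step wt wt-τ G = ∑-perms-pairing τ F H
      (All.map (λ (u , complete) → pair-identity _ u (complete a) (complete b)) (perms-complete n))
      where
      open ≡-Reasoning
      F H : List (Fin n) → ℤ
      F w = sign w * wt w * G (des w)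
      H w = sign w * (wt w * + adjacencies A B w) * Δ G (des w)
      pair-identity : ∀ w → Unique w → a ∈ w → b ∈ w → F w + F (map τ⟨_⟩ w) ≡ H w + H (map τ⟨_⟩ w)
      pair-identity w u a∈w b∈w = begin
        F w + F (map τ⟨_⟩ w)
          ≡⟨ cong₂ (λ s t → F w + s * t * G d′) (sign-τ w u a∈w b∈w) (wt-τ w) ⟩
        s * t * G d + (- s) * t * G d′
          ≡⟨ factor s t (G d) (G d′) ⟩
        s * t * (G d - G d′)
          ≡⟨ cong (s * t *_) (difference-by-Δ G (adjacencies-unique (ℕP.1+n≢n ∘ sym) w u) (des-τ w)) ⟩
        s * t * (+ α * Δ G d - + β * Δ G d′)
          ≡⟨ unfactor s t (+ α) (+ β) (Δ G d) (Δ G d′) ⟩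
        s * (t * + α) * Δ G d + (- s) * (t * + β) * Δ G d′
          ≡⟨ cong₂ (λ s′ t′ → H w + s′ * (t′ * + β) * Δ G d′) (sym (sign-τ w u a∈w b∈w)) (sym (wt-τ w)) ⟩
        H w + sign (map τ⟨_⟩ w) * (wt (map τ⟨_⟩ w) * + β) * Δ G d′
          ≡⟨ cong (λ k → H w + sign (map τ⟨_⟩ w) * (wt (map τ⟨_⟩ w) * + k) * Δ G d′) (sym (adjacencies-τ-swapped w)) ⟩
        H w + H (map τ⟨_⟩ w) ∎
        where
        s t : ℤ
        s = sign w
        t = wt w
        d d′ α β : ℕ
        d  = des w
        d′ = des (map τ⟨_⟩ w)
        α  = adjacencies A B w
        β  = adjacencies B A w
        factor : ∀ s t x y → s * t * x + (- s) * t * y ≡ s * t * (x - y)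
        factor = solve-∀
        unfactor : ∀ s t α β x y → s * t * (α * x - β * y) ≡ s * (t * α) * x + (- s) * (t * β) * y
        unfactor = solve-∀

  module _ {n : ℕ} where

    signed-sum-iterate : ∀ j → 2 ℕ.* j ℕ.≤ n → (g : ℕ → ℤ) →
      ∑[ w ∈ perms n ] sign w * g (des w) ≡ ∑[ w ∈ perms n ] sign w * adjacencyProduct j w * Δ^ j g (des w)
    signed-sum-iterate zero _ g = ∑-cong (λ w → cong (_* g (des w)) (sym (ℤP.*-identityʳ (sign w)))) (perms n)
    signed-sum-iterate (suc j) 2+2j≤n g = begin
      ∑[ w ∈ perms n ] sign w * g (des w)
        ≡⟨ signed-sum-iterate j (ℕP.≤-trans (ℕP.n≤1+n _) (ℕP.<⇒≤ 1+2j<n)) g ⟩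
      ∑[ w ∈ perms n ] sign w * adjacencyProduct j w * Δ^ j g (des w)
        ≡⟨ signed-sum-step (adjacencyProduct j) (adjacencyProduct-τ j 2j≤A) (Δ^ j g) ⟩
      ∑[ w ∈ perms n ] sign w * (adjacencyProduct j w * + adjacencies (toℕ a) (suc (toℕ a)) w) * Δ^ (suc j) g (des w)
        ≡⟨ ∑-cong (λ w → cong (λ p → sign w * (adjacencyProduct j w * + adjacencies p (suc p) w) * Δ^ (suc j) g (des w))
                                (toℕ-fromℕ< 2j<n)) (perms n) ⟩
      ∑[ w ∈ perms n ] sign w * adjacencyProduct (suc j) w * Δ^ (suc j) g (des w) ∎
      where
      open ≡-Reasoning
      1+2j<n : suc (2 ℕ.* j) < n
      1+2j<n = subst (ℕ._≤ n) (ℕP.*-suc 2 j) 2+2j≤n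
      2j<n : 2 ℕ.* j < n
      2j<n = ℕP.<-trans (ℕP.n<1+n _) 1+2j<n
      a b : Fin n
      a = fromℕ< 2j<n
      b = fromℕ< 1+2j<n
      b≡1+a : toℕ b ≡ suc (toℕ a)
      b≡1+a = trans (toℕ-fromℕ< 1+2j<n) (cong suc (sym (toℕ-fromℕ< 2j<n)))
      open PairingStep a b b≡1+a using (signed-sum-step; adjacencyProduct-τ)
      2j≤A : 2 ℕ.* j ℕ.≤ toℕ a
      2j≤A = ℕP.≤-reflexive (sym (toℕ-fromℕ< 2j<n))

    signed-power-sum-vanishes : ∀ {r} → r < n / 2 → ∑[ w ∈ perms n ] sign w * power r (des w) ≡ 0ℤ
    signed-power-sum-vanishes {r} r<n/2 = begin
      ∑[ w ∈ perms n ] sign w * power r (des w)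
        ≡⟨ signed-sum-iterate (n / 2) 2[n/2]≤n (power r) ⟩
      ∑[ w ∈ perms n ] sign w * adjacencyProduct (n / 2) w * Δ^ (n / 2) (power r) (des w)
        ≡⟨ ∑-cong (λ w → trans (cong (sign w * adjacencyProduct (n / 2) w *_) (Δ^-power-above r<n/2 (des w)))
                               (ℤP.*-zeroʳ (sign w * adjacencyProduct (n / 2) w))) (perms n) ⟩
      ∑[ w ∈ perms n ] 0ℤ
        ≡⟨ ∑-zero (perms n) ⟩
      0ℤ ∎
      where
      open ≡-Reasoning
      2[n/2]≤n : 2 ℕ.* (n / 2) ℕ.≤ n
      2[n/2]≤n = subst (ℕ._≤ n) (ℕP.*-comm (n / 2) 2) (m/n*n≤m n 2)

    ∑-sign : ∀ (f : List (Fin n) → ℕ) L →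
             ∑[ w ∈ L ] sign w * + f w ≡ + sum (map f (filterᵇ isEven L)) - + sum (map f (filterᵇ (not ∘ isEven) L))
    ∑-sign f []       = refl
    ∑-sign f (w ∷ ws) with isEven w
    ... | true  = trans (cong (_+_ (1ℤ * + f w)) (∑-sign f ws))
                        (trans (gain (+ f w) (+ P) (+ N)) (cong (_- + N) (sym (ℤP.pos-+ (f w) P))))
      where
      P = sum (map f (filterᵇ isEven ws))
      N = sum (map f (filterᵇ (not ∘ isEven) ws))
      gain : ∀ x p q → 1ℤ * x + (p - q) ≡ (x + p) - q
      gain = solve-∀
    ... | false = trans (cong (_+_ (-1ℤ * + f w)) (∑-sign f ws))
                        (trans (loss (+ f w) (+ P) (+ N)) (cong (_-_ (+ P)) (sym (ℤP.pos-+ (f w) N))))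
      where
      P = sum (map f (filterᵇ isEven ws))
      N = sum (map f (filterᵇ (not ∘ isEven) ws))
      loss : ∀ x p q → -1ℤ * x + (p - q) ≡ p - (x + q)
      loss = solve-∀

  powerSum-balanced : ∀ n {r} → r < n / 2 → powerSum r (permsPos n) ≡ powerSum r (permsNeg n)
  powerSum-balanced n {r} r<n/2 =
    ℤP.+-injective (ℤP.i-j≡0⇒i≡j (+ powerSum r (permsPos n)) (+ powerSum r (permsNeg n))
      (trans (sym (∑-sign (λ w → (des w ℕ.+ 1) ℕ.^ r) (perms n))) (signed-power-sum-vanishes {n} r<n/2)))


open import Data.Nat using (_+_; _*_; _/_; z≤n; s≤s)
open import Data.Nat.Properties using (+-assoc; ≤-trans; +-commutativeSemigroup)
open import Algebra.Properties.CommutativeSemigroup +-commutativeSemigroup using (x∙yz≈y∙xz)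
import Data.Nat.Tactic.RingSolver as ℕ-Solver

sum-split : ∀ {n} (f : List (Fin n) → ℕ) L →
            sum (map f L) ≡ sum (map f (filterᵇ isEven L)) + sum (map f (filterᵇ (not ∘ isEven) L))
sum-split f []       = refl
sum-split f (w ∷ ws) with isEven w
... | true  = trans (cong (f w +_) (sum-split f ws)) (sym (+-assoc (f w) _ _))
... | false = trans (cong (f w +_) (sum-split f ws))
                    (x∙yz≈y∙xz (f w) (sum (map f (filterᵇ isEven ws))) (sum (map f (filterᵇ (not ∘ isEven) ws))))

length≡powerSum-0 : ∀ {n} (L : List (List (Fin n))) → length L ≡ powerSum 0 L
length≡powerSum-0 []       = refl
length≡powerSum-0 (w ∷ ws) = cong suc (length≡powerSum-0 ws)

length-perms-split : ∀ n → length (perms n) ≡ length (permsPos n) + length (permsNeg n)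
length-perms-split n = begin
  length (perms n)                                  ≡⟨ length≡powerSum-0 (perms n) ⟩
  powerSum 0 (perms n)                              ≡⟨ sum-split _ (perms n) ⟩
  powerSum 0 (permsPos n) + powerSum 0 (permsNeg n) ≡⟨ sym (cong₂ _+_ (length≡powerSum-0 (permsPos n))
                                                                        (length≡powerSum-0 (permsNeg n))) ⟩
  length (permsPos n) + length (permsNeg n)         ∎
  where open ≡-Reasoning

length-balanced : ∀ n → 0 < n / 2 → length (permsPos n) ≡ length (permsNeg n)
length-balanced n 0<n/2 = begin
  length (permsPos n)     ≡⟨ length≡powerSum-0 (permsPos n) ⟩
  powerSum 0 (permsPos n) ≡⟨ powerSum-balanced n 0<n/2 ⟩
  powerSum 0 (permsNeg n) ≡⟨ sym (length≡powerSum-0 (permsNeg n)) ⟩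
  length (permsNeg n)     ∎
  where open ≡-Reasoning

cross-multiply : ∀ {ℓ ℓ⁺ ℓ⁻ s s⁺ s⁻} → ℓ ≡ ℓ⁺ + ℓ⁻ → s ≡ s⁺ + s⁻ → ℓ⁺ ≡ ℓ⁻ → s⁺ ≡ s⁻ →
                 (ℓ * s⁺ ≡ ℓ⁺ * s) × (ℓ * s⁻ ≡ ℓ⁻ * s)
cross-multiply {ℓ⁻ = ℓ⁻} {s⁻ = s⁻} refl refl refl refl = halves ℓ⁻ s⁻ , halves ℓ⁻ s⁻
  where
  halves : ∀ x y → (x + x) * y ≡ x * (y + y)
  halves = ℕ-Solver.solve-∀

proposition3p2 : (r n : ℕ) → 1 ≤ r → r < n / 2 →
    (length (perms n) * powerSum r (permsPos n) ≡ length (permsPos n) * powerSum r (perms n))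
    × (length (perms n) * powerSum r (permsNeg n) ≡ length (permsNeg n) * powerSum r (perms n))
proposition3p2 r n _ r<n/2 =
  cross-multiply (length-perms-split n) (sum-split _ (perms n))
                 (length-balanced n (≤-trans (s≤s z≤n) r<n/2)) (powerSum-balanced n r<n/2)
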